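{- Let $k\geq 3$ be an integer and let \[ A=\{0,1\}\cup\{3,4,\ldots,k-1\}\cup\{k+2\}\subseteq \mathbb{Z}_{2k} \] (a set of cardinality $k$). Then for every subset $B\subseteq\mathbb{Z}_{2k}$ with $|B|=k$ such that $A+B\neq \mathbb{Z}_{2k}$, we have $|A+B|\geq \tfrac{3}{2}k$.
   Context: $U+V=\{u+v:u\in U,v\in V\}$ denotes the sumset in $\mathbb{Z}_{2k}$. -}

module Defs where

open import Data.Nat using (ℕ; zero; suc; _+_; _*_; _≤_; _<_; _≡ᵇ_; _<ᵇ_; NonZero)
open import Data.Nat.DivMod using (_%_; m%n<n)
open import Data.Nat.Properties using (_≟_)
open import Data.Bool using (Bool; true; false; _∨_; _∧_; not)
open import Data.Fin using (Fin; toℕ; fromℕ<)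
open import Data.Fin.Subset using (Subset; inside; outside)
open import Data.Fin.Subset.Properties using (_∈?_)
open import Data.Fin.Properties using (any?)
open import Data.Vec using (tabulate)
open import Data.Product using (_×_; _,_)
open import Relation.Nullary using (Dec; yes; no; does)
open import Relation.Nullary.Decidable using (_×-dec_)
open import Relation.Binary.PropositionalEquality using (_≡_)

_⊕_ : ∀ {n} .{{_ : NonZero n}} → Fin n → Fin n → Fin n
_⊕_ {n} x y = fromℕ< (m%n<n (toℕ x + toℕ y) n)

sumset : ∀ {n} .{{_ : NonZero n}} → Subset n → Subset n → Subset n
sumset U V = tabulate λ x →
  Data.Bool.if does (any? λ u → any? λ v → (u ∈? U) ×-dec ((v ∈? V) ×-dec ((u ⊕ v) Data.Fin.≟ x)))
  then inside else outside

inA : ℕ → ℕ → Bool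
inA k m = (m ≡ᵇ 0) ∨ (m ≡ᵇ 1) ∨ ((2 <ᵇ m) ∧ (m <ᵇ k)) ∨ (m ≡ᵇ (k + 2))

setA : ∀ k → Subset (2 * k)
setA k = tabulate λ x → Data.Bool.if inA k (toℕ x) then inside else outside

module Submission where

-- Write n = 2k, A = {0,1} ∪ {3,…,k-1} ∪ {k+2} ⊆ ℤ_n and S = A + B, and let x ∉ S.
--
-- 1. Reflection.  For b ∈ B we have x − b ∉ A, so the reflection x − B is contained
--    in the complement ∁A.  Reflection c ↦ x − c is a permutation of ℤ_n, hence
--    |x − B| = |B| = k = n − |A| = |∁A|, and so x − B = ∁A: every c ∉ A has x − c ∈ B.
-- 2. Differences.  Every nonzero residue d is a difference a − c with a ∈ A, c ∉ A
--    (an explicit case analysis on d).  Then y = a + (x − c) ∈ S whenever y − x = d.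
-- 3. Hence S contains every residue except x, so |S| ≥ 2k − 1 ≥ 3k/2.

open import Defs
open import Data.Nat using (ℕ; zero; suc; _+_; _*_; _∸_; _≤_; _<_; z≤n; s≤s; NonZero; _≡ᵇ_; _<ᵇ_)
open import Data.Nat.Properties
open import Data.Nat.DivMod using (_%_; m%n<n; %-distribˡ-+; m%n%n≡m%n; [m+n]%n≡m%n; m<n⇒m%n≡m)
open import Data.Nat.Tactic.RingSolver using (solve-∀)
open import Data.Bool using (Bool; true; false; if_then_else_)
open import Data.Fin using (Fin; toℕ; fromℕ<)
open import Data.Fin.Properties using (toℕ-fromℕ<; toℕ-injective; toℕ<n; any?)
open import Data.Fin.Permutation using (Permutation; _⟨$⟩ʳ_; permutation)
open import Data.Fin.Subset using (Subset; ∣_∣; ⊤; inside; outside; _∈_; _∉_; _⊆_; ∁; ⁅_⁆)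
open import Data.Fin.Subset.Properties using (_∈?_; ⊆⊤; ⊆-antisym; p⊆q⇒∣p∣≤∣q∣; p⊂q⇒∣p∣<∣q∣; ∣∁p∣≡n∸∣p∣; ∣⁅x⁆∣≡1; x∉⁅y⁆⇒x≢y; x∈∁p⇒x∉p; x∉p⇒x∈∁p)
open import Data.Vec using ([]; _∷_; lookup; tabulate)
open import Data.Vec.Properties using (lookup∘tabulate; lookup⇒[]=; []=⇒lookup)
open import Data.Product using (∃; _×_; _,_)
open import Data.Sum using (_⊎_; inj₁; inj₂)
open import Data.Empty using (⊥-elim)
open import Relation.Nullary using (¬_; yes; no)
open import Relation.Nullary.Decidable using (_×-dec_; ¬?; dec-true; dec-false; decidable-stable)
open import Relation.Binary.PropositionalEquality using (_≡_; _≢_; refl; sym; trans; cong; cong₂; subst; subst₂; module ≡-Reasoning)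
open import Algebra.Properties.CommutativeMonoid.Sum +-0-commutativeMonoid using (sum; sum-permute; sum-cong-≗)

indicator : Bool → ℕ
indicator true = 1
indicator false = 0

select : ∀ {n} → (Fin n → Bool) → Subset n
select f = tabulate (λ x → if f x then inside else outside)

∈-select : ∀ {n} {f : Fin n → Bool} {x} → f x ≡ true → x ∈ select f
∈-select {f = f} {x} fx = lookup⇒[]= x (select f)
  (trans (lookup∘tabulate _ x) (cong (λ b → if b then inside else outside) fx))

∉-select : ∀ {n} {f : Fin n → Bool} {x} → f x ≡ false → x ∉ select f
∉-select {f = f} {x} fx x∈ with trans (sym ([]=⇒lookup x∈))
  (trans (lookup∘tabulate _ x) (cong (λ b → if b then inside else outside) fx))
... | ()

-- The preimage of a subset under a map of points; x − B is the preimage of B under x − _.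
preimage : ∀ {n} → (Fin n → Fin n) → Subset n → Subset n
preimage g p = tabulate (λ i → lookup p (g i))

∈-preimage⁻ : ∀ {n} {g : Fin n → Fin n} {p x} → x ∈ preimage g p → g x ∈ p
∈-preimage⁻ {g = g} {p} {x} x∈ = lookup⇒[]= (g x) p
  (trans (sym (lookup∘tabulate (λ i → lookup p (g i)) x)) ([]=⇒lookup x∈))

-- Cardinality as the sum of indicator values, so that summation lemmas apply.
∣p∣≡Σ : ∀ {n} (p : Subset n) → ∣ p ∣ ≡ sum (λ i → indicator (lookup p i))
∣p∣≡Σ [] = refl
∣p∣≡Σ (true ∷ p) = cong suc (∣p∣≡Σ p)
∣p∣≡Σ (false ∷ p) = ∣p∣≡Σ p

∣preimage∣ : ∀ {n} (π : Permutation n n) (p : Subset n) → ∣ preimage (π ⟨$⟩ʳ_) p ∣ ≡ ∣ p ∣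
∣preimage∣ {n} π p = begin
  ∣ preimage (π ⟨$⟩ʳ_) p ∣                       ≡⟨ ∣p∣≡Σ (preimage (π ⟨$⟩ʳ_) p) ⟩
  sum (λ i → indicator (lookup (preimage (π ⟨$⟩ʳ_) p) i)) ≡⟨ sum-cong-≗ {n} (λ i → cong indicator (lookup∘tabulate _ i)) ⟩
  sum (λ i → indicator (lookup p (π ⟨$⟩ʳ i)))     ≡⟨ sum-permute (λ i → indicator (lookup p i)) π ⟨
  sum (λ i → indicator (lookup p i))              ≡⟨ ∣p∣≡Σ p ⟨
  ∣ p ∣                                           ∎
  where open ≡-Reasoning

module _ {n : ℕ} where

  missed-point : (S : Subset n) → S ≢ ⊤ → ∃ λ x → x ∉ S
  missed-point S S≢⊤ with any? (λ x → ¬? (x ∈? S))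
  ... | yes found = found
  ... | no none = ⊥-elim (S≢⊤ (⊆-antisym ⊆⊤ λ {x} _ →
          decidable-stable (x ∈? S) (λ x∉S → none (x , x∉S))))

  ⊆-card-⊇ : {p q : Subset n} → p ⊆ q → ∣ q ∣ ≤ ∣ p ∣ → q ⊆ p
  ⊆-card-⊇ {p} p⊆q ∣q∣≤∣p∣ {x} x∈q with x ∈? p
  ... | yes x∈p = x∈p
  ... | no x∉p = ⊥-elim (<⇒≱ (p⊂q⇒∣p∣<∣q∣ (p⊆q , x , x∈q , x∉p)) ∣q∣≤∣p∣)

  all-but-one-card : (S : Subset n) (x : Fin n) → (∀ y → y ≢ x → y ∈ S) → n ∸ 1 ≤ ∣ S ∣
  all-but-one-card S x cover = begin
    n ∸ 1             ≡⟨ cong (n ∸_) (∣⁅x⁆∣≡1 x) ⟨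
    n ∸ ∣ ⁅ x ⁆ ∣     ≡⟨ ∣∁p∣≡n∸∣p∣ ⁅ x ⁆ ⟨
    ∣ ∁ ⁅ x ⁆ ∣       ≤⟨ p⊆q⇒∣p∣≤∣q∣ (λ {y} y∈ → cover y (x∉⁅y⁆⇒x≢y (x∈∁p⇒x∉p y∈))) ⟩
    ∣ S ∣             ∎
    where open ≤-Reasoning

countBelow : (ℕ → Bool) → ℕ → ℕ
countBelow f zero = 0
countBelow f (suc l) = indicator (f 0) + countBelow (λ m → f (suc m)) l

∣select-toℕ∣ : ∀ n (f : ℕ → Bool) → ∣ select {n} (λ i → f (toℕ i)) ∣ ≡ countBelow f n
∣select-toℕ∣ zero f = refl
∣select-toℕ∣ (suc n) f with f 0 | ∣select-toℕ∣ n (λ m → f (suc m))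
... | true | ih = cong suc ih
... | false | ih = ih

countBelow-+ : ∀ a b f → countBelow f (a + b) ≡ countBelow f a + countBelow (λ m → f (a + m)) b
countBelow-+ zero b f = refl
countBelow-+ (suc a) b f = trans (cong (indicator (f 0) +_) (countBelow-+ a b (λ m → f (suc m))))
                                 (sym (+-assoc (indicator (f 0)) _ _))

countBelow-true : ∀ l f → (∀ m → m < l → f m ≡ true) → countBelow f l ≡ l
countBelow-true zero f _ = refl
countBelow-true (suc l) f all = cong₂ _+_ (cong indicator (all 0 (s≤s z≤n)))
  (countBelow-true l (λ m → f (suc m)) (λ m m<l → all (suc m) (s≤s m<l)))

countBelow-false : ∀ l f → (∀ m → f m ≡ false) → countBelow f l ≡ 0
countBelow-false zero f _ = refl
countBelow-false (suc l) f none =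
  cong₂ _+_ (cong indicator (none 0)) (countBelow-false l (λ m → f (suc m)) (λ m → none (suc m)))

module _ {n : ℕ} .{{_ : NonZero n}} where

  -- The residue class of a natural number; by definition x ⊕ y = [ toℕ x + toℕ y ].
  [_] : ℕ → Fin n
  [ m ] = fromℕ< (m%n<n m n)

  toℕ-[] : ∀ m → toℕ [ m ] ≡ m % n
  toℕ-[] m = toℕ-fromℕ< (m%n<n m n)

  []-cong : ∀ {m m′} → m % n ≡ m′ % n → [ m ] ≡ [ m′ ]
  []-cong {m} {m′} eq = toℕ-injective (trans (toℕ-[] m) (trans eq (sym (toℕ-[] m′))))

  [toℕ] : ∀ x → [ toℕ x ] ≡ x
  [toℕ] x = toℕ-injective (trans (toℕ-[] (toℕ x)) (m<n⇒m%n≡m (toℕ<n x)))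

  [+n] : ∀ a → [ a + n ] ≡ [ a ]
  [+n] a = []-cong ([m+n]%n≡m%n a n)

  [%+] : ∀ a b → [ a % n + b ] ≡ [ a + b ]
  [%+] a b = []-cong (begin
    (a % n + b) % n           ≡⟨ %-distribˡ-+ (a % n) b n ⟩
    (a % n % n + b % n) % n   ≡⟨ cong (λ t → (t + b % n) % n) (m%n%n≡m%n a n) ⟩
    (a % n + b % n) % n       ≡⟨ %-distribˡ-+ a b n ⟨
    (a + b) % n               ∎)
    where open ≡-Reasoning

  [+%] : ∀ a b → [ a + b % n ] ≡ [ a + b ]
  [+%] a b = trans (cong [_] (+-comm a (b % n))) (trans ([%+] b a) (cong [_] (+-comm b a)))

  ⊕-comm : ∀ x y → x ⊕ y ≡ y ⊕ x
  ⊕-comm x y = cong [_] (+-comm (toℕ x) (toℕ y))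

  ⊕-assoc : ∀ x y z → (x ⊕ y) ⊕ z ≡ x ⊕ (y ⊕ z)
  ⊕-assoc x y z = begin
    [ toℕ [ toℕ x + toℕ y ] + toℕ z ]   ≡⟨ cong (λ t → [ t + toℕ z ]) (toℕ-[] _) ⟩
    [ (toℕ x + toℕ y) % n + toℕ z ]     ≡⟨ [%+] (toℕ x + toℕ y) (toℕ z) ⟩
    [ toℕ x + toℕ y + toℕ z ]           ≡⟨ cong [_] (+-assoc (toℕ x) (toℕ y) (toℕ z)) ⟩
    [ toℕ x + (toℕ y + toℕ z) ]         ≡⟨ [+%] (toℕ x) (toℕ y + toℕ z) ⟨
    [ toℕ x + (toℕ y + toℕ z) % n ]     ≡⟨ cong (λ t → [ toℕ x + t ]) (toℕ-[] _) ⟨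
    [ toℕ x + toℕ [ toℕ y + toℕ z ] ]   ∎
    where open ≡-Reasoning

  _⊖_ : Fin n → Fin n → Fin n
  x ⊖ y = [ toℕ x + (n ∸ toℕ y) ]

  ⊖-⊕-cancel : ∀ x y → (x ⊖ y) ⊕ y ≡ x
  ⊖-⊕-cancel x y = begin
    [ toℕ [ toℕ x + (n ∸ toℕ y) ] + toℕ y ]   ≡⟨ cong (λ t → [ t + toℕ y ]) (toℕ-[] _) ⟩
    [ (toℕ x + (n ∸ toℕ y)) % n + toℕ y ]     ≡⟨ [%+] (toℕ x + (n ∸ toℕ y)) (toℕ y) ⟩
    [ toℕ x + (n ∸ toℕ y) + toℕ y ]           ≡⟨ cong [_] (+-assoc (toℕ x) (n ∸ toℕ y) (toℕ y)) ⟩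
    [ toℕ x + ((n ∸ toℕ y) + toℕ y) ]         ≡⟨ cong (λ t → [ toℕ x + t ]) (m∸n+n≡m (<⇒≤ (toℕ<n y))) ⟩
    [ toℕ x + n ]                             ≡⟨ [+n] (toℕ x) ⟩
    [ toℕ x ]                                 ≡⟨ [toℕ] x ⟩
    x                                         ∎
    where open ≡-Reasoning

  ⊕-⊖-cancel : ∀ x y → (x ⊕ y) ⊖ y ≡ x
  ⊕-⊖-cancel x y = begin
    [ toℕ [ toℕ x + toℕ y ] + (n ∸ toℕ y) ]   ≡⟨ cong (λ t → [ t + (n ∸ toℕ y) ]) (toℕ-[] _) ⟩
    [ (toℕ x + toℕ y) % n + (n ∸ toℕ y) ]     ≡⟨ [%+] (toℕ x + toℕ y) (n ∸ toℕ y) ⟩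
    [ toℕ x + toℕ y + (n ∸ toℕ y) ]           ≡⟨ cong [_] (+-assoc (toℕ x) (toℕ y) (n ∸ toℕ y)) ⟩
    [ toℕ x + (toℕ y + (n ∸ toℕ y)) ]         ≡⟨ cong (λ t → [ toℕ x + t ]) (m+[n∸m]≡n (<⇒≤ (toℕ<n y))) ⟩
    [ toℕ x + n ]                             ≡⟨ [+n] (toℕ x) ⟩
    [ toℕ x ]                                 ≡⟨ [toℕ] x ⟩
    x                                         ∎
    where open ≡-Reasoning

  ⊖-involutive : ∀ x y → x ⊖ (x ⊖ y) ≡ y
  ⊖-involutive x y = begin
    x ⊖ (x ⊖ y)               ≡⟨ cong (_⊖ (x ⊖ y)) (trans (⊕-comm y (x ⊖ y)) (⊖-⊕-cancel x y)) ⟨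
    (y ⊕ (x ⊖ y)) ⊖ (x ⊖ y)   ≡⟨ ⊕-⊖-cancel y (x ⊖ y) ⟩
    y                         ∎
    where open ≡-Reasoning

  reflection : Fin n → Permutation n n
  reflection x = permutation (x ⊖_) (x ⊖_) (⊖-involutive x) (⊖-involutive x)

  ⊖-zero : ∀ x y → toℕ (y ⊖ x) ≡ 0 → y ≡ x
  ⊖-zero x y eq = begin
    y                      ≡⟨ ⊖-⊕-cancel y x ⟨
    [ toℕ (y ⊖ x) + toℕ x ] ≡⟨ cong (λ t → [ t + toℕ x ]) eq ⟩
    [ toℕ x ]              ≡⟨ [toℕ] x ⟩
    x                      ∎
    where open ≡-Reasoning

  -- The identity a + (x − c) = y for a = c + (y − x), used to hit y with a sum.
  ⊕-⊖-recombine : ∀ x y c → (c ⊕ (y ⊖ x)) ⊕ (x ⊖ c) ≡ y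
  ⊕-⊖-recombine x y c = begin
    (c ⊕ (y ⊖ x)) ⊕ (x ⊖ c)   ≡⟨ cong (_⊕ (x ⊖ c)) (⊕-comm c (y ⊖ x)) ⟩
    ((y ⊖ x) ⊕ c) ⊕ (x ⊖ c)   ≡⟨ ⊕-assoc (y ⊖ x) c (x ⊖ c) ⟩
    (y ⊖ x) ⊕ (c ⊕ (x ⊖ c))   ≡⟨ cong ((y ⊖ x) ⊕_) (trans (⊕-comm c (x ⊖ c)) (⊖-⊕-cancel x c)) ⟩
    (y ⊖ x) ⊕ x               ≡⟨ ⊖-⊕-cancel y x ⟩
    y                         ∎
    where open ≡-Reasoning

  ∈-sumset : ∀ {U V : Subset n} {u v} → u ∈ U → v ∈ V → u ⊕ v ∈ sumset U V
  ∈-sumset {U} {V} {u} {v} u∈U v∈V = ∈-select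
    (dec-true (any? λ u′ → any? λ v′ → (u′ ∈? U) ×-dec ((v′ ∈? V) ×-dec ((u′ ⊕ v′) Data.Fin.≟ (u ⊕ v))))
              (u , v , u∈U , v∈V , refl))

  reflected-complement : (U V : Subset n) (x : Fin n) → n ≤ ∣ U ∣ + ∣ V ∣ →
    x ∉ sumset U V → ∀ c → c ∉ U → x ⊖ c ∈ V
  reflected-complement U V x n≤∣U∣+∣V∣ x∉S c c∉U = ∈-preimage⁻ (∁U⊆R (x∉p⇒x∈∁p c∉U))
    where
      R : Subset n
      R = preimage (x ⊖_) V

      R⊆∁U : R ⊆ ∁ U
      R⊆∁U {c} c∈R = x∉p⇒x∈∁p λ c∈U →
        x∉S (subst (_∈ sumset U V) (trans (⊕-comm c (x ⊖ c)) (⊖-⊕-cancel x c))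
                   (∈-sumset c∈U (∈-preimage⁻ c∈R)))

      ∣∁U∣≤∣R∣ : ∣ ∁ U ∣ ≤ ∣ R ∣
      ∣∁U∣≤∣R∣ = begin
        ∣ ∁ U ∣     ≡⟨ ∣∁p∣≡n∸∣p∣ U ⟩
        n ∸ ∣ U ∣   ≤⟨ m≤n+o⇒m∸n≤o n ∣ U ∣ n≤∣U∣+∣V∣ ⟩
        ∣ V ∣       ≡⟨ ∣preimage∣ (reflection x) V ⟨
        ∣ R ∣       ∎
        where open ≤-Reasoning

      ∁U⊆R : ∁ U ⊆ R
      ∁U⊆R = ⊆-card-⊇ R⊆∁U ∣∁U∣≤∣R∣

  covers-all-but : (U V : Subset n) (x : Fin n) → (∀ c → c ∉ U → x ⊖ c ∈ V) →
    (∀ d → toℕ d ≢ 0 → ∃ λ c → c ∉ U × c ⊕ d ∈ U) → ∀ y → y ≢ x → y ∈ sumset U V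
  covers-all-but U V x reflect differences y y≢x with differences (y ⊖ x) (λ eq → y≢x (⊖-zero x y eq))
  ... | c , c∉U , a∈U = subst (_∈ sumset U V) (⊕-⊖-recombine x y c) (∈-sumset a∈U (reflect c c∉U))

  sumset-almost-full : (U V : Subset n) → n ≤ ∣ U ∣ + ∣ V ∣ →
    (∀ d → toℕ d ≢ 0 → ∃ λ c → c ∉ U × c ⊕ d ∈ U) → sumset U V ≢ ⊤ → n ∸ 1 ≤ ∣ sumset U V ∣
  sumset-almost-full U V n≤∣U∣+∣V∣ differences U+V≢⊤ with missed-point (sumset U V) U+V≢⊤
  ... | x , x∉S = all-but-one-card (sumset U V) x
    (covers-all-but U V x (reflected-complement U V x n≤∣U∣+∣V∣ x∉S) differences)

≡ᵇ-false : ∀ {m n} → m ≢ n → (m ≡ᵇ n) ≡ false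
≡ᵇ-false {m} {n} = dec-false (m ≟ n)

≡ᵇ-refl : ∀ m → (m ≡ᵇ m) ≡ true
≡ᵇ-refl m = dec-true (m ≟ m) refl

<ᵇ-true : ∀ {m n} → m < n → (m <ᵇ n) ≡ true
<ᵇ-true {m} {n} = dec-true (m <? n)

<ᵇ-false : ∀ {m n} → ¬ m < n → (m <ᵇ n) ≡ false
<ᵇ-false {m} {n} = dec-false (m <? n)

inA-mid : ∀ {k m} → 2 < m → m < k → inA k m ≡ true
inA-mid {k} {m} 2<m m<k
  rewrite ≡ᵇ-false (>⇒≢ (<-trans (s≤s z≤n) 2<m)) | ≡ᵇ-false (>⇒≢ (<-trans (s≤s (s≤s z≤n)) 2<m))
        | <ᵇ-true 2<m | <ᵇ-true m<k = refl

inA-top : ∀ {k} → 0 < k → inA k (k + 2) ≡ true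
inA-top {k} 0<k
  rewrite ≡ᵇ-false {k + 2} {0} (>⇒≢ (≤-trans (s≤s z≤n) (m≤n+m 2 k)))
        | ≡ᵇ-false {k + 2} {1} (>⇒≢ (subst (1 <_) (+-comm 2 k) (s≤s (s≤s z≤n))))
        | <ᵇ-true (subst (2 <_) (+-comm 2 k) (+-monoʳ-< 2 0<k))
        | <ᵇ-false (λ k+2<k → <⇒≱ k+2<k (m≤m+n k 2)) | ≡ᵇ-refl (k + 2) = refl

inA-beyond : ∀ {k m} → 2 < m → k ≤ m → m ≢ k + 2 → inA k m ≡ false
inA-beyond {k} {m} 2<m k≤m m≢k+2
  rewrite ≡ᵇ-false (>⇒≢ (<-trans (s≤s z≤n) 2<m)) | ≡ᵇ-false (>⇒≢ (<-trans (s≤s (s≤s z≤n)) 2<m))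
        | <ᵇ-true 2<m | <ᵇ-false (≤⇒≯ k≤m) | ≡ᵇ-false m≢k+2 = refl

∈-setA : ∀ {k} {x : Fin (2 * k)} → inA k (toℕ x) ≡ true → x ∈ setA k
∈-setA {k} = ∈-select {f = λ x → inA k (toℕ x)}

∉-setA : ∀ {k} {x : Fin (2 * k)} → inA k (toℕ x) ≡ false → x ∉ setA k
∉-setA {k} = ∉-select {f = λ x → inA k (toℕ x)}

-- |A| = k: A has 0, 1 below 3, all of 3…k−1, and only k+2 in k…2k−1.
∣setA∣ : ∀ j → ∣ setA (3 + j) ∣ ≡ 3 + j
∣setA∣ j = begin
  ∣ setA k ∣                                   ≡⟨ ∣select-toℕ∣ (2 * k) (inA k) ⟩
  countBelow (inA k) (2 * k)                   ≡⟨ cong (λ t → countBelow (inA k) (3 + (j + t))) (+-identityʳ k) ⟩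
  2 + countBelow (λ m → inA k (3 + m)) (j + k) ≡⟨ cong (2 +_) (countBelow-+ j k (λ m → inA k (3 + m))) ⟩
  2 + (countBelow (λ m → inA k (3 + m)) j + countBelow (λ m → inA k (k + m)) k)
    ≡⟨ cong₂ (λ a b → 2 + (a + b)) (countBelow-true j _ middle) upper ⟩
  2 + (j + 1)                                  ≡⟨ cong (2 +_) (+-comm j 1) ⟩
  3 + j                                        ∎
  where
    open ≡-Reasoning
    k = 3 + j

    middle : ∀ m → m < j → inA k (3 + m) ≡ true
    middle m m<j = inA-mid (s≤s (s≤s (s≤s z≤n))) (s≤s (s≤s (s≤s m<j)))

    above : ∀ m → 2 < m → k + m ≢ k + 2
    above m 2<m = >⇒≢ (+-monoʳ-< k 2<m)

    upper : countBelow (λ m → inA k (k + m)) k ≡ 1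
    upper rewrite inA-beyond {k} {k + 0} (s≤s (s≤s (s≤s z≤n))) (m≤m+n k 0) (<⇒≢ (+-monoʳ-< k (s≤s z≤n)))
                | inA-beyond {k} {k + 1} (s≤s (s≤s (s≤s z≤n))) (m≤m+n k 1) (<⇒≢ (+-monoʳ-< k (s≤s (s≤s z≤n))))
                | inA-top {k} (s≤s z≤n)
      = cong suc (countBelow-false j _ λ m →
          inA-beyond (s≤s (s≤s (s≤s z≤n))) (m≤m+n k (3 + m)) (above (3 + m) (s≤s (s≤s (s≤s z≤n)))))

-- A certificate in ℕ that d ≡ a − c (mod 2k) with a ∈ A and c ∉ A.
record Difference (k d : ℕ) : Set where
  constructor difference
  field
    c a : ℕ
    c∉A : inA k c ≡ false
    a∈A : inA k a ≡ true
    c<2k : c < 2 * k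
    a<2k : a < 2 * k
    c+d≡a : c + d ≡ a ⊎ c + d ≡ a + 2 * k

%-wrap : ∀ m .{{_ : NonZero m}} {s a} → a < m → s ≡ a ⊎ s ≡ a + m → s % m ≡ a
%-wrap m a<m (inj₁ refl) = m<n⇒m%n≡m a<m
%-wrap m {a = a} a<m (inj₂ refl) = trans ([m+n]%n≡m%n a m) (m<n⇒m%n≡m a<m)

below2k : ∀ j {m} → m ≤ 5 + j + j → m < 2 * (3 + j)
below2k j {m} m≤ = subst (m <_) (sym (double j)) (s≤s m≤)
  where
    double : ∀ j → 2 * (3 + j) ≡ 6 + j + j
    double = solve-∀

≤k+2⇒<2k : ∀ j {m} → m ≤ 5 + j → m < 2 * (3 + j)
≤k+2⇒<2k j m≤ = below2k j (≤-trans m≤ (m≤m+n (5 + j) j))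

-- In the last range d = (k + 2) + e we have e ≤ k − 3.
last-range : ∀ j e → suc j + (4 + e) < 2 * (3 + j) → e ≤ j
last-range j e lt = ≤-pred (+-cancelˡ-≤ (5 + j) _ _ (subst₂ _≤_ (eqˡ j e) (eqʳ j) lt))
  where
    eqˡ : ∀ j e → suc (suc j + (4 + e)) ≡ 5 + j + suc e
    eqˡ = solve-∀
    eqʳ : ∀ j → 2 * (3 + j) ≡ 5 + j + suc j
    eqʳ = solve-∀

2<3+m : ∀ {m} → 2 < 3 + m
2<3+m = s≤s (s≤s (s≤s z≤n))

-- The witnesses (c, a), with c + d ≡ a modulo 2k, for d ≥ k − 2, written d = (k − 2) + o:
--   d = k − 2: (4, 5) if k = 3 and (k + 3, 1) otherwise;    d = k − 1: (k + 1, 0);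
--   d = k: (2, k + 2);    d = k + 1: (k, 1);    d = k + 2 + e < 2k − 1: (k + 1, 3 + e);
--   d = 2k − 1: (2, 1).
large-differences : ∀ j o → suc j + o < 2 * (3 + j) → Difference (3 + j) (suc j + o)
large-differences zero 0 _ =
  difference 4 5 refl refl (≤k+2⇒<2k 0 (s≤s (s≤s (s≤s (s≤s z≤n))))) (≤k+2⇒<2k 0 ≤-refl) (inj₁ refl)
large-differences (suc i) 0 _ = difference (7 + i) 1
  (inA-beyond 2<3+m (m≤n+m (4 + i) 3) (>⇒≢ (s≤s (s≤s (s≤s (s≤s (s≤s (≤-reflexive (+-comm i 2)))))))))
  refl (below2k (suc i) (s≤s (s≤s (s≤s (s≤s (s≤s (s≤s (m≤n+m (suc i) i))))))))
  (≤k+2⇒<2k (suc i) (s≤s z≤n)) (inj₂ (eq i))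
  where eq : ∀ i → 7 + i + (2 + i + 0) ≡ 1 + 2 * (4 + i)
        eq = solve-∀
large-differences j 1 _ = difference (4 + j) 0
  (inA-beyond 2<3+m (n≤1+n (3 + j)) (<⇒≢ (s≤s (s≤s (s≤s (≤-reflexive (+-comm 2 j)))))))
  refl (≤k+2⇒<2k j (n≤1+n (4 + j))) (≤k+2⇒<2k j z≤n) (inj₂ (eq j))
  where eq : ∀ j → 4 + j + (suc j + 1) ≡ 0 + 2 * (3 + j)
        eq = solve-∀
large-differences j 2 _ = difference 2 (3 + j + 2) refl (inA-top {3 + j} (s≤s z≤n))
  (≤k+2⇒<2k j (s≤s (s≤s z≤n))) (≤k+2⇒<2k j (s≤s (s≤s (s≤s (≤-reflexive (+-comm j 2)))))) (inj₁ refl)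
large-differences j 3 _ = difference (3 + j) 1
  (inA-beyond 2<3+m ≤-refl (<⇒≢ (m<m+n (3 + j) (s≤s z≤n))))
  refl (≤k+2⇒<2k j (m≤n+m (3 + j) 2)) (≤k+2⇒<2k j (s≤s z≤n)) (inj₂ (eq j))
  where eq : ∀ j → 3 + j + (suc j + 3) ≡ 1 + 2 * (3 + j)
        eq = solve-∀
large-differences j (suc (suc (suc (suc e)))) d<2k with m≤n⇒m<n∨m≡n (last-range j e d<2k)
... | inj₁ e<j = difference (4 + j) (3 + e)
  (inA-beyond 2<3+m (n≤1+n (3 + j)) (<⇒≢ (s≤s (s≤s (s≤s (≤-reflexive (+-comm 2 j)))))))
  (inA-mid 2<3+m (s≤s (s≤s (s≤s e<j))))
  (≤k+2⇒<2k j (n≤1+n (4 + j))) (≤k+2⇒<2k j (s≤s (s≤s (s≤s (≤-trans (<⇒≤ e<j) (m≤n+m j 2))))))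
  (inj₂ (eq j e))
  where eq : ∀ j e → 4 + j + (suc j + (4 + e)) ≡ 3 + e + 2 * (3 + j)
        eq = solve-∀
... | inj₂ refl = difference 2 1 refl refl (≤k+2⇒<2k j (s≤s (s≤s z≤n))) (≤k+2⇒<2k j (s≤s z≤n)) (inj₂ (eq j))
  where eq : ∀ j → 2 + (suc j + (4 + j)) ≡ 1 + 2 * (3 + j)
        eq = solve-∀

-- Every 0 < d < 2k is a difference a − c with a ∈ A, c ∉ A; for d ≤ k − 3 take (c, a) = (2, 2 + d).
differences : ∀ j d → 0 < d → d < 2 * (3 + j) → Difference (3 + j) d
differences j d 0<d d<2k with d ≤? j
... | yes d≤j = difference 2 (2 + d) refl (inA-mid (s≤s (s≤s 0<d)) (s≤s (s≤s (s≤s d≤j))))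
      (≤k+2⇒<2k j (s≤s (s≤s z≤n))) (≤k+2⇒<2k j (s≤s (s≤s (≤-trans d≤j (m≤n+m j 3))))) (inj₁ refl)
... | no d≰j with m≤n⇒∃[o]m+o≡n (≰⇒> d≰j)
...   | o , refl = large-differences j o d<2k

nonzero-differences : ∀ j (d : Fin (2 * (3 + j))) → toℕ d ≢ 0 →
  ∃ λ c → c ∉ setA (3 + j) × c ⊕ d ∈ setA (3 + j)
nonzero-differences j d d≢0 with differences j (toℕ d) (n≢0⇒n>0 d≢0) (toℕ<n d)
... | difference c a c∉A a∈A c<2k a<2k c+d≡a =
  fromℕ< c<2k , ∉-setA {3 + j} (trans (cong (inA (3 + j)) (toℕ-fromℕ< c<2k)) c∉A) ,
  ∈-setA {3 + j} (trans (cong (inA (3 + j)) toℕ-sum) a∈A)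
  where
    toℕ-sum : toℕ (fromℕ< c<2k ⊕ d) ≡ a
    toℕ-sum = begin
      toℕ (fromℕ< c<2k ⊕ d)               ≡⟨ toℕ-[] (toℕ (fromℕ< c<2k) + toℕ d) ⟩
      (toℕ (fromℕ< c<2k) + toℕ d) % 2k    ≡⟨ cong (λ t → (t + toℕ d) % 2k) (toℕ-fromℕ< c<2k) ⟩
      (c + toℕ d) % 2k                    ≡⟨ %-wrap 2k a<2k c+d≡a ⟩
      a                                   ∎
      where open ≡-Reasoning
            2k = 2 * (3 + j)

three-halves : ∀ k s → 2 ≤ k → 2 * k ∸ 1 ≤ s → 3 * k ≤ 2 * s
three-halves k s 2≤k 2k∸1≤s = +-cancelʳ-≤ 2 (3 * k) (2 * s) (begin
  3 * k + 2       ≤⟨ +-monoʳ-≤ (3 * k) 2≤k ⟩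
  3 * k + k       ≡⟨ eqˡ k ⟩
  2 * (2 * k)     ≤⟨ *-monoʳ-≤ 2 (≤-trans (m≤n+m∸n (2 * k) 1) (+-monoʳ-≤ 1 2k∸1≤s)) ⟩
  2 * (1 + s)     ≡⟨ eqʳ s ⟩
  2 * s + 2       ∎)
  where
    open ≤-Reasoning
    eqˡ : ∀ k → 3 * k + k ≡ 2 * (2 * k)
    eqˡ = solve-∀
    eqʳ : ∀ s → 2 * (1 + s) ≡ 2 * s + 2
    eqʳ = solve-∀

mainTheorem2 : (k : ℕ) → 3 ≤ k → .{{_ : NonZero (2 * k)}} →
    (B : Subset (2 * k)) → ∣ B ∣ ≡ k → sumset (setA k) B ≢ ⊤ →
    3 * k ≤ 2 * ∣ sumset (setA k) B ∣
mainTheorem2 (suc (suc (suc j))) (s≤s (s≤s (s≤s z≤n))) B ∣B∣≡k A+B≢⊤ =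
  three-halves k ∣ sumset (setA k) B ∣ (s≤s (s≤s z≤n))
    (sumset-almost-full (setA k) B 2k≤∣A∣+∣B∣ (nonzero-differences j) A+B≢⊤)
  where
    k = 3 + j

    2k≤∣A∣+∣B∣ : 2 * k ≤ ∣ setA k ∣ + ∣ B ∣
    2k≤∣A∣+∣B∣ = ≤-reflexive (trans (cong (k +_) (+-identityʳ k)) (sym (cong₂ _+_ (∣setA∣ j) ∣B∣≡k)))
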